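{- Given a signature $(S,F,P)$, consider the following procedure: initialize $S_{0I} := \emptyset$ and $S_{0F} := S$; then repeat, until an iteration produces no change, the updates $S_{0I} := S_{0I} \cup \{ s \in S \mid \forall (g: s_1 \times \cdots \times s_n \to s) \in F_s\ \forall i \in \{1,\dots,n\}: s_i \in S_{0I} \}$ and $S_{0F} := S_{0F} \setminus \{ s \in S \mid \exists (g: s_1 \times \cdots \times s_n \to s) \in F_s\ \forall i \in \{1,\dots,n\}: s_i \notin S_{0F} \}$. Then the resulting sets are exactly $S_{0F}$, the set of sorts having no finite tree, and $S_{0I}$, the set of sorts having no infinite tree.
   Context: A signature $(S,F,P)$: $S$ is a set of sorts; $F$ a set of function symbols (generators), each with an arity $g: s_1\times\cdots\times s_n\to s$ ($n\ge0$), in which case $g$ is a generator of $s$; $F_s$ denotes the set of generators of $s$, assumed nonempty, and every sort is assumed to have at least two generators; $P=\{\mathrm{fin}_s : s\in S\}$. A tree of sort $s$ is a (possibly infinite) rooted ordered tree whose nodes are labeled by generators, the root being labeled by some $g: s_1\times\cdots\times s_n\to s$ in $F_s$ and its $n$ children, in order, being roots of trees of sorts $s_1,\dots,s_n$. A tree is finite if it has finitely many nodes. -}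

module Defs where

open import Data.Nat using (ℕ; _≤_)
open import Data.Fin using (Fin)
open import Data.Bool using (Bool; _∨_; _∧_; not)
open import Data.Vec using (tabulate; lookup)
open import Data.Product using (Σ; _×_; _,_)
open import Data.Fin.Subset using (Subset; _∈_)
open import Data.Fin.Subset.Properties using (_∈?_)
open import Data.Fin.Properties using (all?; any?)
open import Relation.Nullary using (¬_; does; ¬?)


-- Sorts are Fin nSorts; the generators
-- of sort s are indexed by Fin (nGen s); generator g of sort s has arity
-- g : arg s g 0 × ... × arg s g (arity s g - 1) → s.
-- (The predicate symbols P = {fin_s} carry no data.)
record Signature : Set where
  field
    nSorts : ℕ
    nGen   : Fin nSorts → ℕ
    arity  : (s : Fin nSorts) → Fin (nGen s) → ℕ
    arg    : (s : Fin nSorts) (g : Fin (nGen s)) → Fin (arity s g) → Fin nSorts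

module _ (Σs : Signature) where
  open Signature Σs

  AtLeastTwoGenerators : Set
  AtLeastTwoGenerators = (s : Fin nSorts) → 2 ≤ nGen s

  -- A tree is presented by labelling
  -- every "address" with a generator: Path s s' is a finite sequence of
  -- (generator, argument position) choices leading from sort s to sort s'.
  -- The node reached at an address is the one obtained by following the
  -- argument positions; the root label is lab here and the i-th subtree of
  -- the root is obtained by prefixing addresses with (root, i).  (Labels on
  -- addresses not consistent with the tree are irrelevant.)  Every tree in
  -- the sense of the paper arises this way.
  data Path (s : Fin nSorts) : Fin nSorts → Set where
    here  : Path s s
    there : ∀ {s'} (g : Fin (nGen s)) (i : Fin (arity s g)) →
            Path (arg s g i) s' → Path s s'

  record Tree (s : Fin nSorts) : Set where
    constructor mkTree
    field
      lab : ∀ {s'} → Path s s' → Fin (nGen s')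
  open Tree public

  root : ∀ {s} → Tree s → Fin (nGen s)
  root t = lab t here

  child : ∀ {s} (t : Tree s) (i : Fin (arity s (root t))) → Tree (arg s (root t) i)
  child t i = mkTree λ p → lab t (there (root t) i p)

  -- a tree is finite iff it has finitely many nodes; since trees are
  -- finitely branching this is the inductive (well-founded) predicate:
  data Finite {s : Fin nSorts} (t : Tree s) : Set where
    finite : ((i : Fin (arity s (root t))) → Finite (child t i)) → Finite t

  Infinite : {s : Fin nSorts} → Tree s → Set
  Infinite t = ¬ Finite t

  HasNoFiniteTree : Fin nSorts → Set
  HasNoFiniteTree s = ¬ Σ (Tree s) Finite

  HasNoInfiniteTree : Fin nSorts → Set
  HasNoInfiniteTree s = ¬ Σ (Tree s) Infinite

  stepI : Subset nSorts → Subset nSorts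
  stepI X = tabulate λ s →
    lookup X s ∨ does (all? λ g → all? λ i → arg s g i ∈? X)

  stepF : Subset nSorts → Subset nSorts
  stepF Y = tabulate λ s →
    lookup Y s ∧ not (does (any? λ g → all? λ i → ¬? (arg s g i ∈? Y)))

  step : Subset nSorts × Subset nSorts → Subset nSorts × Subset nSorts
  step (X , Y) = stepI X , stepF Y

  initial : Subset nSorts × Subset nSorts
  initial = Data.Fin.Subset.⊥ , Data.Fin.Subset.⊤

  run : ℕ → Subset nSorts × Subset nSorts
  run ℕ.zero = initial
  run (ℕ.suc n) = step (run n)

-- Both iterations are monotone — S0I grows, S0F shrinks — so the pair stabilises
-- after at most 2|S| steps.  Along the iteration, every sort in S0I has only finite
-- trees (all generators lead into S0I) and every sort outside S0F has a finite tree
-- (built from a generator whose arguments all lie outside S0F).  Conversely, at a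
-- fixpoint a finite tree of a sort in S0F would need a generator with all arguments
-- outside S0F; and every sort outside S0I has a generator with an argument outside
-- S0I, so always choosing such a generator yields a tree with no finite branch.
module Submission where

open import Defs
open import Data.Bool using (Bool; T)
open import Data.Bool.Properties using (T-≡; T-∨; T-∧) renaming (_≟_ to _≟ᴮ_)
open import Data.Fin using (Fin; fromℕ<)
open import Data.Fin.Properties using (all?; any?; ¬∀⟶∃¬) renaming (_≟_ to _≟ᶠ_)
open import Data.Fin.Subset using (Subset; _∈_; _∉_; _⊆_; _⊂_; ∁; ∣_∣)
open import Data.Fin.Subset.Properties
  using (_∈?_; ∉⊥; ∈⊤; ⊆-antisym; ∣p∣≤n; p⊆q⇒∣p∣≤∣q∣; p⊂q⇒∣p∣<∣q∣; p⊆q⇒∁p⊇∁q; p⊂q⇒∁p⊃∁q)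
open import Data.Nat using (ℕ; zero; suc; _+_; _≤_; _<_; z≤n; s≤s)
open import Data.Nat.Properties using (≤-trans; ≤-<-trans; <⇒≱; +-mono-≤; +-mono-<-≤; +-mono-≤-<)
open import Data.Product using (Σ; ∃; _×_; _,_; proj₁; proj₂)
open import Data.Product.Function.NonDependent.Propositional using (_×-⇔_)
open import Data.Product.Properties using () renaming (≡-dec to ×-≡-dec)
open import Data.Sum using (_⊎_; inj₁; inj₂)
open import Data.Sum.Function.Propositional using (_⊎-⇔_)
open import Data.Vec using (tabulate; lookup)
open import Data.Vec.Properties using ([]=⇒lookup; lookup⇒[]=; lookup∘tabulate; ≡-dec)
open import Function.Bundles using (_⇔_; mk⇔; Equivalence)
open import Function.Properties.Equivalence using () renaming (sym to ⇔-sym; trans to ⇔-trans)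
open import Relation.Binary.Definitions using (DecidableEquality)
open import Relation.Binary.PropositionalEquality using (_≡_; _≢_; refl; sym; cong; cong₂; subst)
open import Relation.Nullary using (¬_; Dec; yes; no; does; ¬?; contradiction; _×-dec_)
open import Relation.Nullary.Decidable using (decidable-stable)

∈⇔T-lookup : ∀ {n} {x : Fin n} {p : Subset n} → x ∈ p ⇔ T (lookup p x)
∈⇔T-lookup {x = x} {p} =
  mk⇔ (λ x∈p → Equivalence.from T-≡ ([]=⇒lookup x∈p))
      (λ t → lookup⇒[]= x p (Equivalence.to T-≡ t))

∈-tabulate : ∀ {n} {x : Fin n} (f : Fin n → Bool) → x ∈ tabulate f ⇔ T (f x)
∈-tabulate {x = x} f = subst (λ b → x ∈ tabulate f ⇔ T b) (lookup∘tabulate f x) ∈⇔T-lookup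

T-does : ∀ {P : Set} (P? : Dec P) → T (does P?) ⇔ P
T-does (yes p) = mk⇔ (λ _ → p) _
T-does (no ¬p) = mk⇔ (λ ()) ¬p

⊆∧≢⇒⊂ : ∀ {n} {p q : Subset n} → p ⊆ q → p ≢ q → p ⊂ q
⊆∧≢⇒⊂ {p = p} {q} p⊆q p≢q with any? (λ x → x ∈? q ×-dec ¬? (x ∈? p))
... | yes (x , x∈q , x∉p) = p⊆q , x , x∈q , x∉p
... | no ¬new = contradiction (⊆-antisym p⊆q q⊆p) p≢q
  where
  q⊆p : q ⊆ p
  q⊆p {x} x∈q = decidable-stable (x ∈? p) (λ x∉p → ¬new (x , x∈q , x∉p))

module _ {A : Set} (_≟_ : DecidableEquality A) (x : ℕ → A) (μ : A → ℕ) {B : ℕ}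
         (μ≤B : ∀ n → μ (x n) ≤ B)
         (μ-increases : ∀ n → x (suc n) ≢ x n → μ (x n) < μ (x (suc n))) where

  μ-grows-or-stabilises : ∀ k → (∃ λ n → x (suc n) ≡ x n) ⊎ k ≤ μ (x k)
  μ-grows-or-stabilises zero = inj₂ z≤n
  μ-grows-or-stabilises (suc k) with μ-grows-or-stabilises k | x (suc k) ≟ x k
  ... | inj₁ stable | _      = inj₁ stable
  ... | inj₂ _      | yes eq = inj₁ (k , eq)
  ... | inj₂ k≤μ    | no neq = inj₂ (≤-<-trans k≤μ (μ-increases k neq))

  sequence-stabilises : ∃ λ n → x (suc n) ≡ x n
  sequence-stabilises with μ-grows-or-stabilises (suc B)
  ... | inj₁ stable = stable
  ... | inj₂ 1+B≤μ  = contradiction (μ≤B (suc B)) (<⇒≱ 1+B≤μ)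

module _ (Σs : Signature) where
  open Signature Σs

  ∈-stepI : ∀ {X : Subset nSorts} {s} →
            s ∈ stepI Σs X ⇔ (s ∈ X ⊎ (∀ g i → arg s g i ∈ X))
  ∈-stepI {X} {s} =
    ⇔-trans (∈-tabulate _)
      (⇔-trans T-∨ (⇔-sym ∈⇔T-lookup ⊎-⇔ T-does (all? λ g → all? λ i → arg s g i ∈? X)))

  ∈-stepF : ∀ {Y : Subset nSorts} {s} →
            s ∈ stepF Σs Y ⇔ (s ∈ Y × ¬ (∃ λ g → ∀ i → arg s g i ∉ Y))
  ∈-stepF {Y} {s} =
    ⇔-trans (∈-tabulate _)
      (⇔-trans T-∧ (⇔-sym ∈⇔T-lookup ×-⇔ T-does (¬? (any? λ g → all? λ i → ¬? (arg s g i ∈? Y)))))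

  ⊆-stepI : ∀ X → X ⊆ stepI Σs X
  ⊆-stepI X s∈X = Equivalence.from ∈-stepI (inj₁ s∈X)

  stepF-⊆ : ∀ Y → stepF Σs Y ⊆ Y
  stepF-⊆ Y s∈stepF = proj₁ (Equivalence.to ∈-stepF s∈stepF)

  measure : Subset nSorts × Subset nSorts → ℕ
  measure (X , Y) = ∣ X ∣ + ∣ ∁ Y ∣

  measure-increases : ∀ XY → step Σs XY ≢ XY → measure XY < measure (step Σs XY)
  measure-increases (X , Y) step≢ with ≡-dec _≟ᴮ_ (stepI Σs X) X
  ... | no stepI≢ =
    +-mono-<-≤ (p⊂q⇒∣p∣<∣q∣ (⊆∧≢⇒⊂ (⊆-stepI X) (λ eq → stepI≢ (sym eq))))
               (p⊆q⇒∣p∣≤∣q∣ (p⊆q⇒∁p⊇∁q (stepF-⊆ Y)))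
  ... | yes stepI≡ =
    +-mono-≤-< (p⊆q⇒∣p∣≤∣q∣ (⊆-stepI X))
               (p⊂q⇒∣p∣<∣q∣ (p⊂q⇒∁p⊃∁q (⊆∧≢⇒⊂ (stepF-⊆ Y) λ stepF≡ → step≢ (cong₂ _,_ stepI≡ stepF≡))))

  run-stabilises : ∃ λ n → step Σs (run Σs n) ≡ run Σs n
  run-stabilises =
    sequence-stabilises (×-≡-dec (≡-dec _≟ᴮ_) (≡-dec _≟ᴮ_)) (run Σs) measure
      (λ n → +-mono-≤ (∣p∣≤n (proj₁ (run Σs n))) (∣p∣≤n (∁ (proj₂ (run Σs n)))))
      (λ n → measure-increases (run Σs n))

  HasFiniteTree : Fin nSorts → Set
  HasFiniteTree s = Σ (Tree Σs s) (Finite Σs)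

  AllTreesFinite : Fin nSorts → Set
  AllTreesFinite s = (t : Tree Σs s) → Finite Σs t

  _≈_ : ∀ {s} → Tree Σs s → Tree Σs s → Set
  t ≈ u = ∀ {s'} (p : Path Σs _ s') → lab t p ≡ lab u p

  Finite-resp-≈ : ∀ {s} {t u : Tree Σs s} → t ≈ u → Finite Σs t → Finite Σs u
  children-finite-resp-≈ : ∀ {s} {t u : Tree Σs s} → t ≈ u →
    ((i : Fin (arity s (root Σs t))) → Finite Σs (child Σs t i)) →
    (i : Fin (arity s (lab u here))) → Finite Σs (mkTree λ p → lab u (there (lab u here) i p))

  Finite-resp-≈ t≈u (finite fin) = finite (children-finite-resp-≈ t≈u fin)

  -- Abstracting the root label of u lets the arities of the two roots be identified.
  children-finite-resp-≈ {t = t} {u} t≈u fin with lab u here | t≈u here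
  ... | .(root Σs t) | refl = λ i → Finite-resp-≈ (λ p → t≈u (there (root Σs t) i p)) (fin i)

  stepI-preserves-AllTreesFinite : ∀ {X} → (∀ {s} → s ∈ X → AllTreesFinite s) →
                                   ∀ {s} → s ∈ stepI Σs X → AllTreesFinite s
  stepI-preserves-AllTreesFinite allFinite s∈stepI t with Equivalence.to ∈-stepI s∈stepI
  ... | inj₁ s∈X     = allFinite s∈X t
  ... | inj₂ args∈X = finite λ i → allFinite (args∈X (root Σs t) i) (child Σs t i)

  ∈-run⇒AllTreesFinite : ∀ n {s} → s ∈ proj₁ (run Σs n) → AllTreesFinite s
  ∈-run⇒AllTreesFinite zero    s∈⊥ = contradiction s∈⊥ ∉⊥
  ∈-run⇒AllTreesFinite (suc n) = stepI-preserves-AllTreesFinite (∈-run⇒AllTreesFinite n)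

  finite⇒∉ : ∀ {Y} → Y ⊆ stepF Σs Y → ∀ {s} {t : Tree Σs s} → Finite Σs t → s ∉ Y
  finite⇒∉ Y⊆stepF {t = t} (finite fin) s∈Y =
    proj₂ (Equivalence.to ∈-stepF (Y⊆stepF s∈Y)) (root Σs t , λ i → finite⇒∉ Y⊆stepF (fin i))

  removed⇒generator-outside : ∀ {Y s} → s ∈ Y → s ∉ stepF Σs Y → ∃ λ g → ∀ i → arg s g i ∉ Y
  removed⇒generator-outside {Y} {s} s∈Y s∉stepF =
    decidable-stable (any? λ g → all? λ i → ¬? (arg s g i ∈? Y))
                     (λ none → s∉stepF (Equivalence.from ∈-stepF (s∈Y , none)))

  closed⇒escaping-argument : ∀ {X} → stepI Σs X ⊆ X →
                             ∀ {s} → s ∉ X → ∃ λ g → ∃ λ i → arg s g i ∉ X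
  closed⇒escaping-argument {X} closed {s} s∉X with
    ¬∀⟶∃¬ _ (λ g → ∀ i → arg s g i ∈ X) (λ g → all? λ i → arg s g i ∈? X)
          (λ all∈X → s∉X (closed (Equivalence.from ∈-stepI (inj₂ all∈X))))
  ... | g , ¬all∈X = g , ¬∀⟶∃¬ _ (λ i → arg s g i ∈ X) (λ i → arg s g i ∈? X) ¬all∈X

  someGenerator : AtLeastTwoGenerators Σs → ∀ s → Fin (nGen s)
  someGenerator two s = fromℕ< (≤-trans (s≤s z≤n) (two s))

  -- A default generator labels the addresses a tree never reaches and the sorts where
  -- any choice will do; this is all that the two-generator assumption is used for.
  module _ (default : ∀ s → Fin (nGen s)) where

    node : ∀ {s} (g : Fin (nGen s)) → ((i : Fin (arity s g)) → Tree Σs (arg s g i)) → Tree Σs s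
    node {s} g ts = mkTree nodeLabel
      where
      nodeLabel : ∀ {s'} → Path Σs s s' → Fin (nGen s')
      nodeLabel here = g
      nodeLabel (there g′ i p) with g′ ≟ᶠ g
      ... | yes refl = lab (ts i) p
      ... | no _     = default _

    child-node : ∀ {s} (g : Fin (nGen s)) ts i → ts i ≈ child Σs (node g ts) i
    child-node g ts i p with g ≟ᶠ g
    ... | yes refl = refl
    ... | no g≢g   = contradiction refl g≢g

    node-finite : ∀ {s} (g : Fin (nGen s)) ts → (∀ i → Finite Σs (ts i)) → Finite Σs (node g ts)
    node-finite g ts fin = finite λ i → Finite-resp-≈ (child-node g ts i) (fin i)

    stepF-preserves-HasFiniteTree : ∀ {Y} → (∀ {s} → s ∉ Y → HasFiniteTree s) →
                                    ∀ {s} → s ∉ stepF Σs Y → HasFiniteTree s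
    stepF-preserves-HasFiniteTree {Y} hasFinite {s} s∉stepF with s ∈? Y
    ... | no s∉Y = hasFinite s∉Y
    ... | yes s∈Y with removed⇒generator-outside s∈Y s∉stepF
    ...   | g , args∉Y = node g subtrees , node-finite g subtrees (λ i → proj₂ (hasFinite (args∉Y i)))
      where subtrees = λ i → proj₁ (hasFinite (args∉Y i))

    ∉-run⇒HasFiniteTree : ∀ n {s} → s ∉ proj₂ (run Σs n) → HasFiniteTree s
    ∉-run⇒HasFiniteTree zero    s∉⊤ = contradiction ∈⊤ s∉⊤
    ∉-run⇒HasFiniteTree (suc n) = stepF-preserves-HasFiniteTree (∉-run⇒HasFiniteTree n)

    module _ {X : Subset nSorts} (closed : stepI Σs X ⊆ X) where

      escapingGenerator : ∀ s → Dec (s ∈ X) → Fin (nGen s)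
      escapingGenerator s (yes _)   = default s
      escapingGenerator s (no s∉X) = proj₁ (closed⇒escaping-argument closed s∉X)

      escapingTree : ∀ s → Tree Σs s
      escapingTree s = mkTree λ {s'} _ → escapingGenerator s' (s' ∈? X)

      escapingTree-infinite : ∀ {s} → s ∉ X → Infinite Σs (escapingTree s)
      escapingTree-infinite {s} s∉X (finite fin) with s ∈? X
      ... | yes s∈X  = s∉X s∈X
      ... | no s∉X′ with proj₂ (closed⇒escaping-argument closed s∉X′)
      ...   | i , arg∉X = escapingTree-infinite arg∉X (fin i)

    ∈-fixpoint⇔HasNoFiniteTree : ∀ n → stepF Σs (proj₂ (run Σs n)) ≡ proj₂ (run Σs n) →
                                 ∀ s → s ∈ proj₂ (run Σs n) ⇔ HasNoFiniteTree Σs s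
    ∈-fixpoint⇔HasNoFiniteTree n fixed s = mk⇔
      (λ s∈Y (t , t-finite) → finite⇒∉ (subst (_ ∈_) (sym fixed)) t-finite s∈Y)
      (λ noFinite → decidable-stable (s ∈? _) (λ s∉Y → noFinite (∉-run⇒HasFiniteTree n s∉Y)))

    ∈-fixpoint⇔HasNoInfiniteTree : ∀ n → stepI Σs (proj₁ (run Σs n)) ≡ proj₁ (run Σs n) →
                                   ∀ s → s ∈ proj₁ (run Σs n) ⇔ HasNoInfiniteTree Σs s
    ∈-fixpoint⇔HasNoInfiniteTree n fixed s = mk⇔
      (λ s∈X (t , t-infinite) → t-infinite (∈-run⇒AllTreesFinite n s∈X t))
      (λ noInfinite → decidable-stable (s ∈? _)
         (λ s∉X → noInfinite (escapingTree closed s , escapingTree-infinite closed s∉X)))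
      where
      closed : stepI Σs (proj₁ (run Σs n)) ⊆ proj₁ (run Σs n)
      closed = subst (_ ∈_) fixed

theorem5 : (Σs : Signature) → AtLeastTwoGenerators Σs →
    Σ ℕ (λ n → step Σs (run Σs n) ≡ run Σs n)
    × ((n : ℕ) → step Σs (run Σs n) ≡ run Σs n →
        ((s : Fin (Signature.nSorts Σs)) →
           (s ∈ proj₂ (run Σs n) ⇔ HasNoFiniteTree Σs s)
           × (s ∈ proj₁ (run Σs n) ⇔ HasNoInfiniteTree Σs s)))
theorem5 Σs two = run-stabilises Σs , λ n fixed s →
    ∈-fixpoint⇔HasNoFiniteTree Σs (someGenerator Σs two) n (cong proj₂ fixed) s
  , ∈-fixpoint⇔HasNoInfiniteTree Σs (someGenerator Σs two) n (cong proj₁ fixed) s
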